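{- Let $j$ be a non-negative integer and $n$ a non-negative integer. Then the number of partitions of $n$ with exactly $j$ even parts equals the number of partitions of $n$ whose largest repeating part is $j$, which in turn equals the number of partitions of $n$ with exactly $j$ parts greater than the mex.
   Context: A partition of $n$ is a non-increasing sequence of positive integers summing to $n$. Parts are counted with multiplicity. A repeating part of a partition is an integer occurring at least twice in it; the largest repeating part is the largest such integer, and is taken to be $0$ if no integer occurs at least twice. The mex of a partition is the least positive integer that is not a part. -}

module Defs where

open import Data.Nat using (ℕ; zero; suc; _+_; _≤_; _<_; _≥_; _≟_; _≤?_; _<?_; _⊔_; _∸_)
open import Data.List using (List; []; _∷_; length; filter; map; concatMap; upTo)
open import Data.Nat.ListAction using (sum)
open import Data.List.Relation.Unary.All using (All)
open import Data.List.Relation.Unary.All using (all?)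
open import Data.List.Membership.DecPropositional _≟_ using (_∈?_)
open import Data.List.Relation.Unary.Linked using (Linked; linked?)
open import Data.Nat.Divisibility using (_∣_; _∣?_)
open import Data.Product using (_×_; Σ; ∃)
open import Relation.Nullary using (Dec; yes; no; ¬_)
open import Relation.Nullary.Decidable using (_×-dec_; ¬?)
open import Relation.Binary.PropositionalEquality using (_≡_)

count : {P : ℕ → Set} → ((a : ℕ) → Dec (P a)) → List ℕ → ℕ
count P? p = length (filter P? p)

NonIncreasing : List ℕ → Set
NonIncreasing = Linked (λ a b → b ≤ a)

IsPartition : ℕ → List ℕ → Set
IsPartition n p = NonIncreasing p × All (λ a → 1 ≤ a) p × sum p ≡ n

isPartition? : ∀ n p → Dec (IsPartition n p)
isPartition? n p =
  linked? (λ a b → b ≤? a) p ×-dec (all? (λ a → 1 ≤? a) p ×-dec (sum p ≟ n))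

-- Candidate generator: gen fuel m n lists (some) non-increasing lists of
-- parts in 1..m summing to n; fuel bounds the recursion.  The final list of
-- partitions is obtained by FILTERING these candidates with the definition
-- IsPartition, so the generator only affects completeness (every partition of
-- n is produced exactly once), not soundness.
gen : ℕ → ℕ → ℕ → List (List ℕ)
gen fuel m zero = [] ∷ []
gen zero m (suc n) = []
gen (suc fuel) m (suc n) =
  concatMap (λ a → map (suc a ∷_) (gen fuel (suc a) (suc n ∸ suc a)))
    (filter (λ a → suc a ≤? m) (upTo (suc n)))

candidates : ℕ → List (List ℕ)
candidates n = gen n n n

partitions : ℕ → List (List ℕ)
partitions n = filter (isPartition? n) (candidates n)

numPartitions : (n : ℕ) {P : List ℕ → Set} → ((p : List ℕ) → Dec (P p)) → ℕ
numPartitions n P? = length (filter P? (partitions n))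

numEvenParts : List ℕ → ℕ
numEvenParts p = count (λ a → 2 ∣? a) p

mult : ℕ → List ℕ → ℕ
mult a p = count (a ≟_) p

largestRepeatingPart : List ℕ → ℕ
largestRepeatingPart [] = 0
largestRepeatingPart (a ∷ p) with 2 ≤? mult a (a ∷ p)
... | yes _ = a ⊔ (largestRepeatingPart p)
... | no _  = largestRepeatingPart p

-- mex: least positive integer that is not a part.  Searched among 1..(length p + 1),
-- which always contains a non-part.
mexFrom : ℕ → ℕ → List ℕ → ℕ
mexFrom zero k p = k
mexFrom (suc fuel) k p with k ∈? p
... | yes _ = mexFrom fuel (suc k) p
... | no _  = k

mex : List ℕ → ℕ
mex p = mexFrom (length p) 1 p

numPartsAboveMex : List ℕ → ℕ
numPartsAboveMex p = count (λ a → mex p <? a) p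

-- Splitting a partition p of n into (δ , ν) with p = δ ∪ 2ν and all parts of δ odd, or with
-- p = δ ∪ ν ∪ ν and all parts of δ distinct, is a bijection onto pairs with |δ| + 2|ν| = n. Counting
-- by |ν| gives p(n) = Σₖ c(n ∸ 2k) p(k) for both splittings, so by induction on n the partitions into
-- odd parts and into distinct parts are equinumerous (Euler). The number of even parts of p is the
-- length of ν for the first splitting, and the largest repeating part of p is the largest part of ν
-- for the second; conjugating ν exchanges these two statistics, which gives the first equality.
-- For the second, reading the Ferrers diagram by columns shows that the number of parts above the mex
-- of p is the largest repeating part of its conjugate, and conjugation is an involution.

module Submission where

open import Defs
open import Data.Nat
  using (ℕ; zero; suc; pred; _+_; _*_; _∸_; _⊔_; _≤_; _<_; _≤′_; ≤′-refl; ≤′-step; _≟_; _≤?_; _<?_; z≤n; s≤s; s≤s⁻¹)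
open import Data.Nat.Properties
open import Data.Nat.Induction using (<-rec)
open import Data.Nat.Tactic.RingSolver using (solve-∀)
open import Data.Nat.DivMod using (_/_; m*n/n≡m; /-monoˡ-≤)
open import Data.Nat.Divisibility using (_∣_; _∣?_; divides)
open import Data.Nat.ListAction using (sum)
open import Data.Nat.ListAction.Properties using (sum-++; sum-↭)
open import Data.List using (List; []; _∷_; [_]; _++_; length; map; filter; concatMap; cartesianProduct; upTo; applyUpTo; foldr)
open import Data.List.Properties
  using ( ∷-injectiveʳ; ++-identityʳ; length-++; length-map; length-applyUpTo; map-upTo; applyUpTo-∷ʳ
        ; filter-accept; filter-reject; filter-all; filter-none; filter-some; filter-++; map-cong; map-cong-local)
open import Data.List.Relation.Unary.All as All using (All; []; _∷_)
import Data.List.Relation.Unary.All.Properties as All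
open import Data.List.Relation.Unary.AllPairs as AllPairs using (AllPairs; []; _∷_)
open import Data.List.Relation.Unary.Any using (here; there)
open import Data.List.Relation.Unary.Unique.Propositional using (Unique)
import Data.List.Relation.Unary.Unique.Propositional.Properties as Unique
open import Data.List.Relation.Binary.Permutation.Propositional
  using (_↭_; ↭-refl; ↭-prep; ↭-reflexive; ↭-sym; ↭-trans; ↭⇒↭ₛ; module PermutationReasoning)
open import Data.List.Relation.Binary.Permutation.Propositional.Properties using (↭-length; filter-↭; All-resp-↭; shift)
open import Data.List.Relation.Binary.Pointwise using (Pointwise-≡⇒≡)
open import Data.List.Membership.Propositional using (_∈_; find; lose)
open import Data.List.Membership.DecPropositional _≟_ using (_∈?_)
open import Data.List.Membership.Propositional.Properties
  using ( ∈-∃++; ∈-++⁻; ∈-++⁺ˡ; ∈-++⁺ʳ; ∈-map⁻; ∈-map⁺; ∈-concatMap⁻; ∈-concatMap⁺; ∈-filter⁺; ∈-filter⁻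
        ; ∈-upTo⁺; ∈-applyUpTo⁻; ∈-cartesianProduct⁺; ∈-cartesianProduct⁻)
open import Relation.Binary.Properties.DecTotalOrder ≤-decTotalOrder using (≥-decTotalOrder; ≥-totalOrder)
open import Data.List.Sort ≥-decTotalOrder using (sort; sort-↭; sort-↗)
import Data.List.Relation.Unary.Sorted.TotalOrder.Properties as Sorted
open import Data.Product using (_×_; _,_; proj₁; proj₂; ∃; map₁)
open import Data.Sum using (_⊎_; inj₁; inj₂; [_,_]′; map₂; swap)
open import Data.Empty using (⊥-elim)
open import Data.Unit using (⊤; tt)
open import Function using (_∘_; _⇔_; mk⇔; Equivalence)
open import Relation.Nullary using (Dec; yes; no; ¬_; ¬?; contradiction)
open import Relation.Unary using (Decidable)
open import Relation.Binary.PropositionalEquality hiding ([_])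

open Equivalence using (to; from)
import Function.Properties.Equivalence as ⇔
open import Algebra.Properties.CommutativeSemigroup +-commutativeSemigroup using (interchange)

module _ {P : ℕ → Set} (P? : Decidable P) where

  count-accept : ∀ {x} xs → P x → count P? (x ∷ xs) ≡ suc (count P? xs)
  count-accept xs px = cong length (filter-accept P? px)

  count-reject : ∀ {x} xs → ¬ P x → count P? (x ∷ xs) ≡ count P? xs
  count-reject xs ¬px = cong length (filter-reject P? ¬px)

  count-++ : ∀ xs ys → count P? (xs ++ ys) ≡ count P? xs + count P? ys
  count-++ xs ys = trans (cong length (filter-++ P? xs ys)) (length-++ (filter P? xs))

  count-↭ : ∀ {xs ys} → xs ↭ ys → count P? xs ≡ count P? ys
  count-↭ = ↭-length ∘ filter-↭ P?

  count-all : ∀ {xs} → All P xs → count P? xs ≡ length xs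
  count-all = cong length ∘ filter-all P?

  count-none : ∀ {xs} → All (¬_ ∘ P) xs → count P? xs ≡ 0
  count-none = cong length ∘ filter-none P?

  count-∷-≥ : ∀ x xs → count P? xs ≤ count P? (x ∷ xs)
  count-∷-≥ x xs with P? x
  ... | yes _ = n≤1+n (count P? xs)
  ... | no _  = ≤-refl

  count-∈ : ∀ {x xs} → x ∈ xs → P x → 0 < count P? xs
  count-∈ x∈xs px = filter-some P? (lose x∈xs px)

  count-pos⇒∃ : ∀ xs → 0 < count P? xs → ∃ λ x → x ∈ xs × P x
  count-pos⇒∃ (x ∷ xs) pos with P? x
  ... | yes px = x , here refl , px
  ... | no _   = let y , y∈xs , py = count-pos⇒∃ xs pos in y , there y∈xs , py

  count-map : (f : ℕ → ℕ) → ∀ xs → count P? (map f xs) ≡ count (P? ∘ f) xs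
  count-map f []       = refl
  count-map f (x ∷ xs) with P? (f x)
  ... | yes _ = cong suc (count-map f xs)
  ... | no _  = count-map f xs

module _ {P Q : ℕ → Set} (P? : Decidable P) (Q? : Decidable Q) where

  count-mono : (∀ {x} → P x → Q x) → ∀ xs → count P? xs ≤ count Q? xs
  count-mono P⇒Q []       = z≤n
  count-mono P⇒Q (x ∷ xs) with P? x | Q? x
  ... | yes _  | yes _  = s≤s (count-mono P⇒Q xs)
  ... | yes px | no ¬qx = contradiction (P⇒Q px) ¬qx
  ... | no _   | yes _  = m≤n⇒m≤1+n (count-mono P⇒Q xs)
  ... | no _   | no _   = count-mono P⇒Q xs

module _ {P Q R : ℕ → Set} (P? : Decidable P) (Q? : Decidable Q) (R? : Decidable R) where

  count-⊎ : (∀ {x} → P x ⇔ (Q x ⊎ R x)) → (∀ {x} → Q x → ¬ R x) →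
            ∀ xs → count P? xs ≡ count Q? xs + count R? xs
  count-⊎ P⇔Q⊎R disjoint []       = refl
  count-⊎ P⇔Q⊎R disjoint (x ∷ xs) with P? x | Q? x | R? x
  ... | _      | yes qx | yes rx = contradiction rx (disjoint qx)
  ... | yes _  | yes _  | no _   = cong suc (count-⊎ P⇔Q⊎R disjoint xs)
  ... | yes _  | no _   | yes _  = trans (cong suc (count-⊎ P⇔Q⊎R disjoint xs)) (sym (+-suc _ _))
  ... | yes px | no ¬qx | no ¬rx = ⊥-elim ([ ¬qx , ¬rx ]′ (to P⇔Q⊎R px))
  ... | no ¬px | yes qx | no _   = contradiction (from P⇔Q⊎R (inj₁ qx)) ¬px
  ... | no ¬px | no _   | yes rx = contradiction (from P⇔Q⊎R (inj₂ rx)) ¬px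
  ... | no _   | no _   | no _   = count-⊎ P⇔Q⊎R disjoint xs

mult-pos⇒∈ : ∀ {x xs} → 0 < mult x xs → x ∈ xs
mult-pos⇒∈ {x} {xs} pos with count-pos⇒∃ (x ≟_) xs pos
... | _ , x∈xs , refl = x∈xs

∈⇒mult-pos : ∀ {x xs} → x ∈ xs → 0 < mult x xs
∈⇒mult-pos x∈xs = count-∈ (_ ≟_) x∈xs refl

∉⇒mult≡0 : ∀ {x xs} → ¬ x ∈ xs → mult x xs ≡ 0
∉⇒mult≡0 x∉xs = n≤0⇒n≡0 (≮⇒≥ (x∉xs ∘ mult-pos⇒∈))

mult-∷-cancel : ∀ {a xs ys} → (∀ c → mult c (a ∷ xs) ≡ mult c (a ∷ ys)) → ∀ c → mult c xs ≡ mult c ys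
mult-∷-cancel {a} {xs} {ys} eq c with c ≟ a
... | yes refl = suc-injective (trans (sym (count-accept (c ≟_) xs refl)) (trans (eq c) (count-accept (c ≟_) ys refl)))
... | no c≢a   = trans (sym (count-reject (c ≟_) xs c≢a)) (trans (eq c) (count-reject (c ≟_) ys c≢a))

mult-∷-≢ : ∀ {a b} p → b ≢ a → mult b (a ∷ p) ≡ mult b p
mult-∷-≢ p = count-reject (_ ≟_) p

NonIncreasing⇒AllPairs : ∀ {xs} → NonIncreasing xs → AllPairs (λ a b → b ≤ a) xs
NonIncreasing⇒AllPairs = Sorted.Sorted⇒AllPairs ≥-totalOrder

nonIncreasing-↭⇒≡ : ∀ {xs ys} → NonIncreasing xs → NonIncreasing ys → xs ↭ ys → xs ≡ ys
nonIncreasing-↭⇒≡ xs↘ ys↘ xs↭ys = Pointwise-≡⇒≡ (Sorted.↗↭↗⇒≋ ≥-totalOrder xs↘ ys↘ (↭⇒↭ₛ xs↭ys))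

mult-nonIncreasing⇒≡ : ∀ {xs ys} → NonIncreasing xs → NonIncreasing ys →
                       (∀ c → mult c xs ≡ mult c ys) → xs ≡ ys
mult-nonIncreasing⇒≡ xs↘ ys↘ = go (NonIncreasing⇒AllPairs xs↘) (NonIncreasing⇒AllPairs ys↘)
  where
  ∈-∷⇒≤head : ∀ {x y ys} → All (_≤ y) ys → x ∈ y ∷ ys → x ≤ y
  ∈-∷⇒≤head _    (here refl)  = ≤-refl
  ∈-∷⇒≤head ys≤y (there x∈ys) = All.lookup ys≤y x∈ys

  head∈ : ∀ {x xs ys} → (∀ c → mult c (x ∷ xs) ≡ mult c ys) → x ∈ ys
  head∈ {x} {xs} eq = mult-pos⇒∈ (subst (0 <_) (trans (sym (count-accept (x ≟_) xs refl)) (eq x)) (s≤s z≤n))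

  go : ∀ {xs ys} → AllPairs (λ a b → b ≤ a) xs → AllPairs (λ a b → b ≤ a) ys →
       (∀ c → mult c xs ≡ mult c ys) → xs ≡ ys
  go {[]}    {[]}    _ _ _  = refl
  go {[]}    {_ ∷ _} _ _ eq with () ← head∈ {ys = []} (sym ∘ eq)
  go {_ ∷ _} {[]}    _ _ eq with () ← head∈ {ys = []} eq
  go {x ∷ xs} {y ∷ ys} (xs≤x ∷ xs↘) (ys≤y ∷ ys↘) eq
    with ≤-antisym (∈-∷⇒≤head ys≤y (head∈ eq)) (∈-∷⇒≤head xs≤x (head∈ (sym ∘ eq)))
  ... | refl = cong (x ∷_) (go xs↘ ys↘ (mult-∷-cancel eq))

sort-isPartition : ∀ {n xs} → All (1 ≤_) xs → sum xs ≡ n → IsPartition n (sort xs)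
sort-isPartition {xs = xs} xs⁺ Σxs≡n =
  sort-↗ xs , All-resp-↭ (↭-sym (sort-↭ xs)) xs⁺ , trans (sum-↭ (sort-↭ xs)) Σxs≡n

module _ {A B : Set} where

  Unique-concatMap : (f : A → List B) (tag : B → A) → (∀ a {b} → b ∈ f a → tag b ≡ a) →
                     (∀ a → Unique (f a)) → ∀ {as} → Unique as → Unique (concatMap f as)
  Unique-concatMap f tag tag-f f! {[]}     []            = []
  Unique-concatMap f tag tag-f f! {a ∷ as} (a∉as ∷ as!) =
    Unique.++⁺ (f! a) (Unique-concatMap f tag tag-f f! as!) disjoint
    where
    disjoint : ∀ {b} → ¬ (b ∈ f a × b ∈ concatMap f as)
    disjoint (b∈fa , b∈rest) with find (∈-concatMap⁻ f {xs = as} b∈rest)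
    ... | a′ , a′∈as , b∈fa′ = All.lookup a∉as a′∈as (trans (sym (tag-f a b∈fa)) (tag-f a′ b∈fa′))

  length-≤-leftInverse : ∀ {xs : List A} {ys : List B} → Unique xs → (f : A → B) (g : B → A) →
                         (∀ {x} → x ∈ xs → f x ∈ ys) → (∀ {x} → x ∈ xs → g (f x) ≡ x) →
                         length xs ≤ length ys
  length-≤-leftInverse {[]}     []           f g maps gf = z≤n
  length-≤-leftInverse {x ∷ xs} (x∉xs ∷ xs!) f g maps gf with ∈-∃++ (maps (here refl))
  ... | ys₁ , ys₂ , refl = begin
    suc (length xs)            ≤⟨ s≤s (length-≤-leftInverse xs! f g maps′ (gf ∘ there)) ⟩
    suc (length (ys₁ ++ ys₂))  ≡⟨ cong suc (length-++ ys₁) ⟩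
    suc (length ys₁ + length ys₂) ≡⟨ +-suc (length ys₁) (length ys₂) ⟨
    length ys₁ + length (f x ∷ ys₂) ≡⟨ length-++ ys₁ ⟨
    length (ys₁ ++ f x ∷ ys₂)  ∎
    where
    open ≤-Reasoning
    maps′ : ∀ {x′} → x′ ∈ xs → f x′ ∈ ys₁ ++ ys₂
    maps′ {x′} x′∈xs with ∈-++⁻ ys₁ (maps (there x′∈xs))
    ... | inj₁ ∈ys₁         = ∈-++⁺ˡ ∈ys₁
    ... | inj₂ (there ∈ys₂) = ∈-++⁺ʳ ys₁ ∈ys₂
    ... | inj₂ (here fx′≡fx) =
      contradiction (trans (sym (gf (there x′∈xs))) (trans (cong g fx′≡fx) (gf (here refl))))
                    (All.lookup x∉xs x′∈xs ∘ sym)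

module _ {A B : Set} where

  length-≡-inverse : ∀ {xs : List A} {ys : List B} → Unique xs → Unique ys → (f : A → B) (g : B → A) →
                     (∀ {x} → x ∈ xs → f x ∈ ys) → (∀ {y} → y ∈ ys → g y ∈ xs) →
                     (∀ {x} → x ∈ xs → g (f x) ≡ x) → (∀ {y} → y ∈ ys → f (g y) ≡ y) →
                     length xs ≡ length ys
  length-≡-inverse xs! ys! f g f-maps g-maps gf fg =
    ≤-antisym (length-≤-leftInverse xs! f g f-maps gf) (length-≤-leftInverse ys! g f g-maps fg)

length-concatMap : ∀ {A B : Set} (f : A → List B) xs → length (concatMap f xs) ≡ sum (map (length ∘ f) xs)
length-concatMap f []       = refl
length-concatMap f (x ∷ xs) = trans (length-++ (f x)) (cong (length (f x) +_) (length-concatMap f xs))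

length-cartesianProduct : ∀ {A B : Set} (xs : List A) (ys : List B) → length (cartesianProduct xs ys) ≡ length xs * length ys
length-cartesianProduct []       ys = refl
length-cartesianProduct (x ∷ xs) ys =
  trans (length-++ (map (x ,_) ys)) (cong₂ _+_ (length-map (x ,_) ys) (length-cartesianProduct xs ys))

Unique-applyUpTo-suc : ∀ n → Unique (applyUpTo suc n)
Unique-applyUpTo-suc n = subst Unique (map-upTo suc n) (Unique.map⁺ suc-injective (Unique.upTo⁺ n))

gen-unique : ∀ fuel m n → Unique (gen fuel m n)
gen-unique fuel       m zero    = [] ∷ []
gen-unique zero       m (suc n) = []
gen-unique (suc fuel) m (suc n) =
  Unique-concatMap _ leadingIndex leadingIndex-∈
    (λ a → Unique.map⁺ ∷-injectiveʳ (gen-unique fuel (suc a) (suc n ∸ suc a)))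
    (Unique.filter⁺ (λ a → suc a ≤? m) (Unique.upTo⁺ (suc n)))
  where
  leadingIndex : List ℕ → ℕ
  leadingIndex []      = 0
  leadingIndex (x ∷ _) = pred x

  leadingIndex-∈ : ∀ a {p} → p ∈ map (suc a ∷_) (gen fuel (suc a) (suc n ∸ suc a)) → leadingIndex p ≡ a
  leadingIndex-∈ a p∈ with ∈-map⁻ (suc a ∷_) p∈
  ... | _ , _ , refl = refl

All-≤-sum : ∀ xs → All (_≤ sum xs) xs
All-≤-sum []       = []
All-≤-sum (x ∷ xs) = m≤m+n x (sum xs) ∷ All.map (λ y≤ → ≤-trans y≤ (m≤n+m (sum xs) x)) (All-≤-sum xs)

∈-gen⁺ : ∀ fuel m {p} → AllPairs (λ a b → b ≤ a) p → All (1 ≤_) p → All (_≤ m) p → sum p ≤ fuel →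
         p ∈ gen fuel m (sum p)
∈-gen⁺ fuel       m {[]}        _          _         _         _            = here refl
∈-gen⁺ fuel       m {zero ∷ p}  _          (() ∷ _)  _         _
∈-gen⁺ zero       m {suc a ∷ p} _          _         _         ()
∈-gen⁺ (suc fuel) m {suc a ∷ p} (p≤ ∷ p↘) (_ ∷ p⁺) (a<m ∷ _) (s≤s ≤fuel) =
  ∈-concatMap⁺ (λ b → map (suc b ∷_) (gen fuel (suc b) (suc (a + sum p) ∸ suc b)))
    (lose a∈indices (∈-map⁺ (suc a ∷_) p∈gen))
  where
  a∈indices : a ∈ filter (λ b → suc b ≤? m) (upTo (suc (a + sum p)))
  a∈indices = ∈-filter⁺ (λ b → suc b ≤? m) (∈-upTo⁺ (s≤s (m≤m+n a (sum p)))) a<m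

  p∈gen : p ∈ gen fuel (suc a) (suc (a + sum p) ∸ suc a)
  p∈gen = subst (λ k → p ∈ gen fuel (suc a) k) (sym (m+n∸m≡n a (sum p)))
            (∈-gen⁺ fuel (suc a) p↘ p⁺ p≤ (≤-trans (m≤n+m (sum p) a) ≤fuel))

partitions-unique : ∀ n → Unique (partitions n)
partitions-unique n = Unique.filter⁺ (isPartition? n) (gen-unique n n n)

∈-partitions⁻ : ∀ {n p} → p ∈ partitions n → IsPartition n p
∈-partitions⁻ {n} = proj₂ ∘ ∈-filter⁻ (isPartition? n) {xs = candidates n}

∈-partitions⁺ : ∀ {n p} → IsPartition n p → p ∈ partitions n
∈-partitions⁺ {n} {p} p⊢n@(p↘ , p⁺ , refl) = ∈-filter⁺ (isPartition? n)
  (∈-gen⁺ n n (NonIncreasing⇒AllPairs p↘) p⁺ (All-≤-sum p) ≤-refl) p⊢n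

module _ (n : ℕ) {P Q : List ℕ → Set} (P? : Decidable P) (Q? : Decidable Q) where

  numPartitions-involution : (f : List ℕ → List ℕ) →
    (∀ {p} → IsPartition n p → IsPartition n (f p)) → (∀ {p} → IsPartition n p → f (f p) ≡ p) →
    (∀ {p} → IsPartition n p → P p → Q (f p)) → (∀ {p} → IsPartition n p → Q p → P (f p)) →
    numPartitions n P? ≡ numPartitions n Q?
  numPartitions-involution f f-⊢ f-f P⇒Q∘f Q⇒P∘f =
    length-≡-inverse (Unique.filter⁺ P? (partitions-unique n)) (Unique.filter⁺ Q? (partitions-unique n)) f f
      (maps P? Q? P⇒Q∘f) (maps Q? P? Q⇒P∘f) (f-f ∘ ⊢-of P?) (f-f ∘ ⊢-of Q?)
    where
    ⊢-of : ∀ {R : List ℕ → Set} (R? : Decidable R) {p} → p ∈ filter R? (partitions n) → IsPartition n p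
    ⊢-of R? = ∈-partitions⁻ ∘ proj₁ ∘ ∈-filter⁻ R? {xs = partitions n}

    maps : ∀ {R S : List ℕ → Set} (R? : Decidable R) (S? : Decidable S) →
           (∀ {p} → IsPartition n p → R p → S (f p)) →
           ∀ {p} → p ∈ filter R? (partitions n) → f p ∈ filter S? (partitions n)
    maps R? S? R⇒S∘f p∈ with ∈-filter⁻ R? {xs = partitions n} p∈
    ... | p∈ₙ , rp = ∈-filter⁺ S? (∈-partitions⁺ (f-⊢ (∈-partitions⁻ p∈ₙ))) (R⇒S∘f (∈-partitions⁻ p∈ₙ) rp)

  numPartitions-cong : (∀ {p} → IsPartition n p → P p ⇔ Q p) → numPartitions n P? ≡ numPartitions n Q?
  numPartitions-cong P⇔Q = numPartitions-involution (λ p → p) (λ p⊢n → p⊢n) (λ _ → refl)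
                             (to ∘ P⇔Q) (from ∘ P⇔Q)

record IsLargestRepeatingPart (p : List ℕ) (j : ℕ) : Set where
  constructor _,_
  field
    repeated   : j ≡ 0 ⊎ 2 ≤ mult j p
    rare-above : ∀ a → j < a → mult a p < 2

largestRepeatingPart-spec : ∀ p → IsLargestRepeatingPart p (largestRepeatingPart p)
largestRepeatingPart-spec []      = inj₁ refl , λ _ _ → s≤s z≤n
largestRepeatingPart-spec (a ∷ p) with 2 ≤? mult a (a ∷ p) | largestRepeatingPart-spec p
... | no ¬rep | j-rep , above-j = repeats-∷ j-rep , above
  where
  above : ∀ b → largestRepeatingPart p < b → mult b (a ∷ p) < 2
  above b j<b with b ≟ a
  ... | yes refl = ≰⇒> ¬rep
  ... | no b≢a   = subst (_< 2) (sym (mult-∷-≢ p b≢a)) (above-j b j<b)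
  repeats-∷ : ∀ {j} → j ≡ 0 ⊎ 2 ≤ mult j p → j ≡ 0 ⊎ 2 ≤ mult j (a ∷ p)
  repeats-∷ = map₂ (λ 2≤ → ≤-trans 2≤ (count-∷-≥ (_ ≟_) a p))
... | yes rep | j-rep , above-j with ≤-total (largestRepeatingPart p) a
...   | inj₁ j≤a rewrite m≥n⇒m⊔n≡m j≤a =
  inj₂ rep , λ b a<b → subst (_< 2) (sym (mult-∷-≢ p (>⇒≢ a<b))) (above-j b (≤-<-trans j≤a a<b))
...   | inj₂ a≤j rewrite m≤n⇒m⊔n≡n a≤j =
  map₂ (λ 2≤ → ≤-trans 2≤ (count-∷-≥ (_ ≟_) a p)) j-rep ,
  λ b j<b → subst (_< 2) (sym (mult-∷-≢ p (>⇒≢ (≤-<-trans a≤j j<b)))) (above-j b j<b)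

IsLargestRepeatingPart-≮ : ∀ {p j j′} → IsLargestRepeatingPart p j → IsLargestRepeatingPart p j′ → ¬ j < j′
IsLargestRepeatingPart-≮ _            (inj₁ refl , _) ()
IsLargestRepeatingPart-≮ (_ , above-j) (inj₂ 2≤ , _)  j<j′ = ≤⇒≯ 2≤ (above-j _ j<j′)

IsLargestRepeatingPart-unique : ∀ {p j j′} → IsLargestRepeatingPart p j → IsLargestRepeatingPart p j′ → j ≡ j′
IsLargestRepeatingPart-unique j-lrp j′-lrp =
  ≤-antisym (≮⇒≥ (IsLargestRepeatingPart-≮ j′-lrp j-lrp)) (≮⇒≥ (IsLargestRepeatingPart-≮ j-lrp j′-lrp))

record IsMex (p : List ℕ) (m : ℕ) : Set where
  field
    positive : 1 ≤ m
    ∉parts   : ¬ m ∈ p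
    below    : ∀ k → 1 ≤ k → k < m → k ∈ p

module _ (p : List ℕ) where

  mexFrom-≥ : ∀ fuel k → k ≤ mexFrom fuel k p
  mexFrom-≥ zero       k = ≤-refl
  mexFrom-≥ (suc fuel) k with k ∈? p
  ... | yes _ = ≤-trans (n≤1+n k) (mexFrom-≥ fuel (suc k))
  ... | no _  = ≤-refl

  mexFrom-below : ∀ fuel k i → k ≤ i → i < mexFrom fuel k p → i ∈ p
  mexFrom-below zero       k i k≤i i<k = contradiction i<k (≤⇒≯ k≤i)
  mexFrom-below (suc fuel) k i k≤i i<m with k ∈? p
  ... | no _    = contradiction i<m (≤⇒≯ k≤i)
  ... | yes k∈p with k ≟ i
  ...   | yes refl = k∈p
  ...   | no k≢i   = mexFrom-below fuel (suc k) i (≤∧≢⇒< k≤i k≢i) i<m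

  mexFrom-∉⊎exhausted : ∀ fuel k → ¬ mexFrom fuel k p ∈ p ⊎ mexFrom fuel k p ≡ k + fuel
  mexFrom-∉⊎exhausted zero       k = inj₂ (sym (+-identityʳ k))
  mexFrom-∉⊎exhausted (suc fuel) k with k ∈? p
  ... | no k∉p = inj₁ k∉p
  ... | yes _  = map₂ (λ eq → trans eq (sym (+-suc k fuel))) (mexFrom-∉⊎exhausted fuel (suc k))

mex-spec : ∀ p → IsMex p (mex p)
mex-spec p = record
  { positive = mexFrom-≥ p (length p) 1
  ; ∉parts   = [ (λ ∉p → ∉p) , mex-∉-exhausted ]′ (mexFrom-∉⊎exhausted p (length p) 1)
  ; below    = mexFrom-below p (length p) 1
  }
  where
  mex-∉-exhausted : mex p ≡ suc (length p) → ¬ mex p ∈ p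
  mex-∉-exhausted m≡ m∈p = <-irrefl refl (begin-strict
    length p                               <⟨ n<1+n (length p) ⟩
    suc (length p)                         ≡⟨ length-applyUpTo suc (suc (length p)) ⟨
    length (applyUpTo suc (suc (length p))) ≤⟨ length-≤-leftInverse (Unique-applyUpTo-suc _) (λ k → k) (λ k → k) ⊆p (λ _ → refl) ⟩
    length p                               ∎)
    where
    open ≤-Reasoning
    ⊆p : ∀ {k} → k ∈ applyUpTo suc (suc (length p)) → k ∈ p
    ⊆p k∈ with ∈-applyUpTo⁻ suc k∈
    ... | i , i<1+l , refl with i ≟ length p
    ...   | yes refl = subst (_∈ p) m≡ m∈p
    ...   | no i≢l   = mexFrom-below p (length p) 1 (suc i) (s≤s z≤n)
                           (subst (suc i <_) (sym m≡) (s≤s (≤∧≢⇒< (s≤s⁻¹ i<1+l) i≢l)))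

lowerBounds⇒≡ : ∀ {x y} → (∀ {k} → 1 ≤ k → k ≤ x ⇔ k ≤ y) → x ≡ y
lowerBounds⇒≡ {zero}  {zero}  _     = refl
lowerBounds⇒≡ {zero}  {suc y} x⇔y with () ← from (x⇔y (s≤s z≤n)) (s≤s z≤n)
lowerBounds⇒≡ {suc x} {zero}  x⇔y with () ← to (x⇔y (s≤s z≤n)) (s≤s z≤n)
lowerBounds⇒≡ {suc x} {suc y} x⇔y = ≤-antisym (to (x⇔y (s≤s z≤n)) ≤-refl) (from (x⇔y (s≤s z≤n)) ≤-refl)

∈-range⁻ : ∀ {M k} → k ∈ applyUpTo suc M → 1 ≤ k × k ≤ M
∈-range⁻ k∈ with ∈-applyUpTo⁻ suc k∈
... | _ , i<M , refl = s≤s z≤n , i<M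

All-range : ∀ {P : ℕ → Set} M → (∀ {k} → 1 ≤ k → k ≤ M → P k) → All P (applyUpTo suc M)
All-range M P-range = All.tabulate (λ k∈ → let 1≤k , k≤M = ∈-range⁻ k∈ in P-range 1≤k k≤M)

module _ {Q : ℕ → Set} (Q↓ : ∀ x → Q (suc x) → Q x) where

  downClosed : ∀ {m n} → m ≤ n → Q n → Q m
  downClosed m≤n = go (≤⇒≤′ m≤n)
    where
    go : ∀ {m n} → m ≤′ n → Q n → Q m
    go ≤′-refl        q = q
    go (≤′-step m≤′n) q = go m≤′n (Q↓ _ q)

count-range-∷ʳ : ∀ {Q : ℕ → Set} (Q? : Decidable Q) M →
                count Q? (applyUpTo suc (suc M)) ≡ count Q? (applyUpTo suc M) + count Q? [ suc M ]
count-range-∷ʳ Q? M = trans (cong (count Q?) (sym (applyUpTo-∷ʳ suc M))) (count-++ Q? (applyUpTo suc M) [ suc M ])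

module _ {Q : ℕ → Set} (Q? : Decidable Q) (Q↓ : ∀ x → Q (suc x) → Q x) where

  count-downClosed-range : ∀ M {k} → 1 ≤ k → (k ≤ count Q? (applyUpTo suc M) ⇔ (k ≤ M × Q k))
  count-downClosed-range zero {k} 1≤k = mk⇔ (λ k≤0 → contradiction (≤-trans 1≤k k≤0) λ ())
                                             (λ (k≤0 , _) → k≤0)
  count-downClosed-range (suc M) {k} 1≤k with Q? (suc M)
  ... | yes q = subst (λ c → k ≤ c ⇔ (k ≤ suc M × Q k)) (sym count≡)
                  (mk⇔ (λ k≤1+M → k≤1+M , downClosed Q↓ k≤1+M q) proj₁)
    where
    open ≡-Reasoning
    all-Q : All Q (applyUpTo suc M)
    all-Q = All-range M (λ _ k≤M → downClosed Q↓ (m≤n⇒m≤1+n k≤M) q)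
    count≡ : count Q? (applyUpTo suc (suc M)) ≡ suc M
    count≡ = begin
      count Q? (applyUpTo suc (suc M))                 ≡⟨ count-range-∷ʳ Q? M ⟩
      count Q? (applyUpTo suc M) + count Q? [ suc M ]  ≡⟨ cong₂ _+_ (count-all Q? all-Q) (count-accept Q? [] q) ⟩
      length (applyUpTo suc M) + 1                     ≡⟨ cong (_+ 1) (length-applyUpTo suc M) ⟩
      M + 1                                            ≡⟨ +-comm M 1 ⟩
      suc M                                            ∎
  ... | no ¬q = subst (λ c → k ≤ c ⇔ (k ≤ suc M × Q k)) (sym count≡)
                  (mk⇔ (map₁ m≤n⇒m≤1+n ∘ to ih) (λ (k≤1+M , qk) → from ih (k≤M k≤1+M qk , qk)))
    where
    ih : k ≤ count Q? (applyUpTo suc M) ⇔ (k ≤ M × Q k)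
    ih = count-downClosed-range M 1≤k
    count≡ : count Q? (applyUpTo suc (suc M)) ≡ count Q? (applyUpTo suc M)
    count≡ = trans (count-range-∷ʳ Q? M)
                   (trans (cong (count Q? (applyUpTo suc M) +_) (count-reject Q? [] ¬q)) (+-identityʳ _))
    k≤M : k ≤ suc M → Q k → k ≤ M
    k≤M k≤1+M qk with k ≟ suc M
    ... | yes refl = contradiction qk ¬q
    ... | no k≢1+M = s≤s⁻¹ (≤∧≢⇒< k≤1+M k≢1+M)

numParts≥ : ℕ → List ℕ → ℕ
numParts≥ k = count (k ≤?_)

largestPart : List ℕ → ℕ
largestPart = foldr _⊔_ 0

conjugate : List ℕ → List ℕ
conjugate p = map (λ k → numParts≥ k p) (applyUpTo suc (largestPart p))

numParts≥-antitone : ∀ p {k k′} → k ≤ k′ → numParts≥ k′ p ≤ numParts≥ k p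
numParts≥-antitone p k≤k′ = count-mono (_ ≤?_) (_ ≤?_) (≤-trans k≤k′) p

numParts≥-split : ∀ k p → numParts≥ k p ≡ mult k p + numParts≥ (suc k) p
numParts≥-split k = count-⊎ (k ≤?_) (k ≟_) (suc k ≤?_)
  (mk⇔ (swap ∘ m≤n⇒m<n∨m≡n) [ ≤-reflexive , <⇒≤ ]′) <-irrefl

largestPart-ub : ∀ p → All (_≤ largestPart p) p
largestPart-ub []      = []
largestPart-ub (a ∷ p) =
  m≤m⊔n a (largestPart p) ∷ All.map (λ b≤ → ≤-trans b≤ (m≤n⊔m a (largestPart p))) (largestPart-ub p)

largestPart-∈ : ∀ p → largestPart p ≡ 0 ⊎ largestPart p ∈ p
largestPart-∈ []      = inj₁ refl
largestPart-∈ (a ∷ p) with ≤-total (largestPart p) a | largestPart-∈ p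
... | inj₁ ≤a | _         = inj₂ (subst (_∈ a ∷ p) (sym (m≥n⇒m⊔n≡m ≤a)) (here refl))
... | inj₂ a≤ | inj₂ ∈p   = inj₂ (subst (_∈ a ∷ p) (sym (m≤n⇒m⊔n≡n a≤)) (there ∈p))
... | inj₂ a≤ | inj₁ ≡0   = inj₁ (trans (m≤n⇒m⊔n≡n a≤) ≡0)

numParts≥-pos⇔ : ∀ p {k} → 1 ≤ k → (0 < numParts≥ k p ⇔ k ≤ largestPart p)
numParts≥-pos⇔ p {k} 1≤k = mk⇔ pos⇒ ⇒pos
  where
  pos⇒ : 0 < numParts≥ k p → k ≤ largestPart p
  pos⇒ pos = let x , x∈p , k≤x = count-pos⇒∃ (k ≤?_) p pos in ≤-trans k≤x (All.lookup (largestPart-ub p) x∈p)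
  ⇒pos : k ≤ largestPart p → 0 < numParts≥ k p
  ⇒pos k≤ with largestPart-∈ p
  ... | inj₁ ≡0  = contradiction (≤-trans 1≤k (subst (k ≤_) ≡0 k≤)) λ ()
  ... | inj₂ ∈p  = count-∈ (k ≤?_) ∈p k≤

ferrers : ∀ p {i k} → 1 ≤ i → 1 ≤ k → (k ≤ numParts≥ i (conjugate p) ⇔ i ≤ numParts≥ k p)
ferrers p {i} {k} 1≤i 1≤k = mk⇔
  (λ k≤ → proj₂ (to range⇔ (subst (k ≤_) count≡ k≤)))
  (λ i≤ → subst (k ≤_) (sym count≡) (from range⇔ (to (numParts≥-pos⇔ p 1≤k) (≤-trans 1≤i i≤) , i≤)))
  where
  count≡ : numParts≥ i (conjugate p) ≡ count (λ x → i ≤? numParts≥ x p) (applyUpTo suc (largestPart p))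
  count≡ = count-map (i ≤?_) (λ x → numParts≥ x p) (applyUpTo suc (largestPart p))
  range⇔ : k ≤ count (λ x → i ≤? numParts≥ x p) (applyUpTo suc (largestPart p)) ⇔
           (k ≤ largestPart p × i ≤ numParts≥ k p)
  range⇔ = count-downClosed-range (λ x → i ≤? numParts≥ x p)
             (λ x i≤ → ≤-trans i≤ (numParts≥-antitone p (n≤1+n x))) (largestPart p) 1≤k

conjugate-nonIncreasing : ∀ p → NonIncreasing (conjugate p)
conjugate-nonIncreasing p = Sorted.map⁺ ≤-totalOrder ≥-totalOrder (numParts≥-antitone p)
  (Sorted.applyUpTo⁺₂ ≤-totalOrder suc (largestPart p) (λ i → n≤1+n (suc i)))

conjugate-positive : ∀ p → All (1 ≤_) (conjugate p)
conjugate-positive p = All.map⁺ (All-range (largestPart p) (λ 1≤k → from (numParts≥-pos⇔ p 1≤k)))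

length-conjugate : ∀ p → length (conjugate p) ≡ largestPart p
length-conjugate p = trans (length-map _ (applyUpTo suc (largestPart p))) (length-applyUpTo suc (largestPart p))

sum-map-+ : (f g : ℕ → ℕ) → ∀ xs → sum (map (λ x → f x + g x) xs) ≡ sum (map f xs) + sum (map g xs)
sum-map-+ f g []       = refl
sum-map-+ f g (x ∷ xs) = trans (cong (f x + g x +_) (sum-map-+ f g xs)) (interchange (f x) (g x) _ _)

sum-map-0 : ∀ (xs : List ℕ) → sum (map (λ _ → 0) xs) ≡ 0
sum-map-0 []       = refl
sum-map-0 (_ ∷ xs) = sum-map-0 xs

sum-map-numParts≥-[_] : ∀ a xs → sum (map (λ k → numParts≥ k [ a ]) xs) ≡ count (_≤? a) xs
sum-map-numParts≥-[ a ] []       = refl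
sum-map-numParts≥-[ a ] (k ∷ xs) with k ≤? a
... | yes k≤a = trans (cong₂ _+_ (count-accept (k ≤?_) [] k≤a) (sum-map-numParts≥-[ a ] xs))
                      (sym (count-accept (_≤? a) xs k≤a))
... | no k≰a  = trans (cong₂ _+_ (count-reject (k ≤?_) [] k≰a) (sum-map-numParts≥-[ a ] xs))
                      (sym (count-reject (_≤? a) xs k≰a))

count-≤-range : ∀ {a M} → a ≤ M → count (_≤? a) (applyUpTo suc M) ≡ a
count-≤-range {a} {M} a≤M = lowerBounds⇒≡ λ 1≤k →
  let range⇔ = count-downClosed-range (_≤? a) (λ _ → <⇒≤) M 1≤k in
  mk⇔ (proj₂ ∘ to range⇔) (λ k≤a → from range⇔ (≤-trans k≤a a≤M , k≤a))

sum-range-numParts≥ : ∀ p M → largestPart p ≤ M → sum (map (λ k → numParts≥ k p) (applyUpTo suc M)) ≡ sum p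
sum-range-numParts≥ []      M _   = sum-map-0 (applyUpTo suc M)
sum-range-numParts≥ (a ∷ p) M ≤M = begin
  sum (map (λ k → numParts≥ k (a ∷ p)) ks)
    ≡⟨ cong sum (map-cong (λ k → count-++ (k ≤?_) [ a ] p) ks) ⟩
  sum (map (λ k → numParts≥ k [ a ] + numParts≥ k p) ks)
    ≡⟨ sum-map-+ (λ k → numParts≥ k [ a ]) (λ k → numParts≥ k p) ks ⟩
  sum (map (λ k → numParts≥ k [ a ]) ks) + sum (map (λ k → numParts≥ k p) ks)
    ≡⟨ cong₂ _+_ (sum-map-numParts≥-[ a ] ks) (sum-range-numParts≥ p M (m⊔n≤o⇒n≤o a _ ≤M)) ⟩
  count (_≤? a) ks + sum p
    ≡⟨ cong (_+ sum p) (count-≤-range (m⊔n≤o⇒m≤o a _ ≤M)) ⟩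
  a + sum p ∎
  where
  open ≡-Reasoning
  ks : List ℕ
  ks = applyUpTo suc M

sum-conjugate : ∀ p → sum (conjugate p) ≡ sum p
sum-conjugate p = sum-range-numParts≥ p (largestPart p) ≤-refl

numParts≥-injective : ∀ {p q} → NonIncreasing p → NonIncreasing q → All (1 ≤_) p → All (1 ≤_) q →
                      (∀ {k} → 1 ≤ k → numParts≥ k p ≡ numParts≥ k q) → p ≡ q
numParts≥-injective {p} {q} p↘ q↘ p⁺ q⁺ p≡q = mult-nonIncreasing⇒≡ p↘ q↘ mult≡
  where
  mult≡ : ∀ c → mult c p ≡ mult c q
  mult≡ zero    = trans (count-none (0 ≟_) (All.map (λ 1≤x 0≡x → <⇒≢ 1≤x 0≡x) p⁺))
                        (sym (count-none (0 ≟_) (All.map (λ 1≤x 0≡x → <⇒≢ 1≤x 0≡x) q⁺)))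
  mult≡ (suc c) = +-cancelʳ-≡ (numParts≥ (suc (suc c)) p) _ _ (begin
    mult (suc c) p + numParts≥ (suc (suc c)) p ≡⟨ numParts≥-split (suc c) p ⟨
    numParts≥ (suc c) p                        ≡⟨ p≡q (s≤s z≤n) ⟩
    numParts≥ (suc c) q                        ≡⟨ numParts≥-split (suc c) q ⟩
    mult (suc c) q + numParts≥ (suc (suc c)) q ≡⟨ cong (mult (suc c) q +_) (p≡q (s≤s z≤n)) ⟨
    mult (suc c) q + numParts≥ (suc (suc c)) p ∎)
    where open ≡-Reasoning

conjugate-involutive : ∀ {p} → NonIncreasing p → All (1 ≤_) p → conjugate (conjugate p) ≡ p
conjugate-involutive {p} p↘ p⁺ =
  numParts≥-injective (conjugate-nonIncreasing (conjugate p)) p↘ (conjugate-positive (conjugate p)) p⁺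
    λ 1≤i → lowerBounds⇒≡ λ 1≤k → ⇔.trans (ferrers (conjugate p) 1≤i 1≤k) (ferrers p 1≤k 1≤i)

conjugate-isPartition : ∀ {n p} → IsPartition n p → IsPartition n (conjugate p)
conjugate-isPartition {p = p} (_ , _ , Σp≡n) = conjugate-nonIncreasing p , conjugate-positive p , trans (sum-conjugate p) Σp≡n

module _ (n : ℕ) {P Q : List ℕ → Set} (P? : Decidable P) (Q? : Decidable Q) where

  numPartitions-conjugate : (∀ {p} → IsPartition n p → P p → Q (conjugate p)) →
                            (∀ {p} → IsPartition n p → Q p → P (conjugate p)) →
                            numPartitions n P? ≡ numPartitions n Q?
  numPartitions-conjugate = numPartitions-involution n P? Q? conjugate conjugate-isPartition
    (λ (p↘ , p⁺ , _) → conjugate-involutive p↘ p⁺)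

largestPart-conjugate : ∀ {n p} → IsPartition n p → largestPart (conjugate p) ≡ length p
largestPart-conjugate {p = p} (p↘ , p⁺ , _) =
  trans (sym (length-conjugate (conjugate p))) (cong length (conjugate-involutive p↘ p⁺))

numPartitions-length≡largestPart : ∀ k j →
  numPartitions k (λ ν → length ν ≟ j) ≡ numPartitions k (λ ν → largestPart ν ≟ j)
numPartitions-length≡largestPart k j = numPartitions-conjugate k (λ ν → length ν ≟ j) (λ ν → largestPart ν ≟ j)
  (λ ν⊢k → trans (largestPart-conjugate ν⊢k)) (λ {ν} _ → trans (length-conjugate ν))

2≤mult⇔ : ∀ c q → 2 ≤ mult c q ⇔ 2 + numParts≥ (suc c) q ≤ numParts≥ c q
2≤mult⇔ c q rewrite numParts≥-split c q = mk⇔ (+-monoˡ-≤ _) (+-cancelʳ-≤ _ 2 _)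

numParts≥-flat⇒∉ : ∀ {c q} → numParts≥ c q ≤ numParts≥ (suc c) q → ¬ c ∈ q
numParts≥-flat⇒∉ {c} {q} ≤suc c∈q = <⇒≱ (∈⇒mult-pos c∈q)
  (+-cancelʳ-≤ (numParts≥ (suc c) q) (mult c q) 0 (subst (_≤ numParts≥ (suc c) q) (numParts≥-split c q) ≤suc))

module _ (p : List ℕ) where

  private
    μ : List ℕ
    μ = conjugate p
    -- `mex p <? a` unfolds to `suc (mex p) ≤? a`, so j is numParts≥ (suc (mex p)) p by definition.
    j : ℕ
    j = numPartsAboveMex p
    open IsMex (mex-spec p)

  numParts≥-mex : numParts≥ (mex p) p ≡ j
  numParts≥-mex = trans (numParts≥-split (mex p) p) (cong (_+ j) (∉⇒mult≡0 ∉parts))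

  conjugate-repeats-numPartsAboveMex : j ≡ 0 ⊎ 2 ≤ mult j μ
  conjugate-repeats-numPartsAboveMex with j in j≡
  ... | zero   = inj₁ refl
  ... | suc j′ = inj₂ (from (2≤mult⇔ (suc j′) μ) (≤-trans (s≤s (≰⇒> N≮m)) column))
    where
    column : suc (mex p) ≤ numParts≥ (suc j′) μ
    column = from (ferrers p (s≤s z≤n) (s≤s z≤n)) (≤-reflexive (sym j≡))
    N≮m : ¬ mex p ≤ numParts≥ (suc (suc j′)) μ
    N≮m m≤N = 1+n≰n (subst (suc (suc j′) ≤_) (trans numParts≥-mex j≡) (to (ferrers p (s≤s z≤n) positive) m≤N))

  conjugate-rare-above-numPartsAboveMex : ∀ a → j < a → mult a μ < 2
  conjugate-rare-above-numPartsAboveMex a j<a = ≰⇒> λ 2≤mult →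
    let gap = to (2≤mult⇔ a μ) 2≤mult in <⇒≱ j<a (begin
    a                         ≤⟨ a≤next gap ⟩
    numParts≥ (suc k) p       ≤⟨ numParts≥-antitone p (s≤s (mex≤k gap)) ⟩
    numParts≥ (suc (mex p)) p ∎)
    where
    open ≤-Reasoning
    1≤a : 1 ≤ a
    1≤a = ≤-trans (s≤s z≤n) j<a
    R k : ℕ
    R = numParts≥ (suc a) μ
    k = suc R
    -- A repeated column a of μ forces numParts≥ k p ≤ a ≤ numParts≥ (suc k) p, so k is not a part of p.
    a≤next : 2 + R ≤ numParts≥ a μ → a ≤ numParts≥ (suc k) p
    a≤next = to (ferrers p 1≤a (s≤s z≤n))
    at-k≤a : numParts≥ k p ≤ a
    at-k≤a = ≮⇒≥ λ a<at-k → 1+n≰n (from (ferrers p (s≤s z≤n) (s≤s z≤n)) a<at-k)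
    mex≤k : 2 + R ≤ numParts≥ a μ → mex p ≤ k
    mex≤k gap = ≮⇒≥ λ k<mex → numParts≥-flat⇒∉ (≤-trans at-k≤a (a≤next gap)) (below k (s≤s z≤n) k<mex)

  numPartsAboveMex≡largestRepeatingPart-conjugate : numPartsAboveMex p ≡ largestRepeatingPart μ
  numPartsAboveMex≡largestRepeatingPart-conjugate = IsLargestRepeatingPart-unique
    (conjugate-repeats-numPartsAboveMex , conjugate-rare-above-numPartsAboveMex) (largestRepeatingPart-spec μ)

Split : (List ℕ → Set) → ℕ → List ℕ → List ℕ → Set
Split Core n δ ν = Core δ × IsPartition (sum δ) δ × IsPartition (sum ν) ν × sum δ + 2 * sum ν ≡ n

record Splitting : Set₁ where
  field
    Core        : List ℕ → Set
    core?       : Decidable Core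
    corePart    : List ℕ → List ℕ
    pairedPart  : List ℕ → List ℕ
    join        : List ℕ → List ℕ → List ℕ
    split-valid : ∀ {n p} → IsPartition n p → Split Core n (corePart p) (pairedPart p)
    join-valid  : ∀ {a b δ ν} → Core δ → IsPartition a δ → IsPartition b ν → IsPartition (a + 2 * b) (join δ ν)
    join-split  : ∀ {n p} → IsPartition n p → join (corePart p) (pairedPart p) ≡ p
    split-join  : ∀ {a b δ ν} → Core δ → IsPartition a δ → IsPartition b ν →
                  corePart (join δ ν) ≡ δ × pairedPart (join δ ν) ≡ ν

halves : ℕ → List ℕ
halves n = filter (λ k → 2 * k ≤? n) (upTo (suc n))

module Decomposition (S : Splitting) {R : List ℕ → Set} (R? : Decidable R) (n : ℕ) where

  open Splitting S

  splitPairsAt : ℕ → List (List ℕ × List ℕ)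
  splitPairsAt k = cartesianProduct (filter core? (partitions (n ∸ 2 * k))) (filter R? (partitions k))

  splitPairs : List (List ℕ × List ℕ)
  splitPairs = concatMap splitPairsAt (halves n)

  ∈-splitPairs⁻ : ∀ {δ ν} → (δ , ν) ∈ splitPairs →
                  Core δ × IsPartition (n ∸ 2 * sum ν) δ × IsPartition (sum ν) ν × R ν × 2 * sum ν ≤ n
  ∈-splitPairs⁻ {δ} {ν} δν∈ with find (∈-concatMap⁻ splitPairsAt {xs = halves n} δν∈)
  ... | k , k∈ , δν∈ₖ with ∈-cartesianProduct⁻ (filter core? (partitions (n ∸ 2 * k))) (filter R? (partitions k)) δν∈ₖ
  ...   | δ∈ , ν∈ with ∈-filter⁻ core? {xs = partitions (n ∸ 2 * k)} δ∈ | ∈-filter⁻ R? {xs = partitions k} ν∈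
  ...     | δ∈ₚ , core-δ | ν∈ₚ , rν with ∈-partitions⁻ {k} ν∈ₚ
  ...       | ν⊢k@(_ , _ , refl) =
    core-δ , ∈-partitions⁻ δ∈ₚ , ν⊢k , rν , proj₂ (∈-filter⁻ (λ k → 2 * k ≤? n) {xs = upTo (suc n)} k∈)

  ∈-splitPairs⁺ : ∀ {δ ν} → Core δ → IsPartition (n ∸ 2 * sum ν) δ → IsPartition (sum ν) ν → R ν →
                  2 * sum ν ≤ n → (δ , ν) ∈ splitPairs
  ∈-splitPairs⁺ {δ} {ν} core-δ δ⊢ ν⊢ rν 2k≤n = ∈-concatMap⁺ splitPairsAt
    (lose (∈-filter⁺ (λ k → 2 * k ≤? n) (∈-upTo⁺ (s≤s (≤-trans (m≤n*m (sum ν) 2) 2k≤n))) 2k≤n)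
          (∈-cartesianProduct⁺ (∈-filter⁺ core? (∈-partitions⁺ δ⊢) core-δ) (∈-filter⁺ R? (∈-partitions⁺ ν⊢) rν)))

  splitPairs-unique : Unique splitPairs
  splitPairs-unique =
    Unique-concatMap splitPairsAt (sum ∘ proj₂) tag
      (λ k → Unique.cartesianProduct⁺ (Unique.filter⁺ core? (partitions-unique (n ∸ 2 * k)))
                                      (Unique.filter⁺ R? (partitions-unique k)))
      (Unique.filter⁺ (λ k → 2 * k ≤? n) (Unique.upTo⁺ (suc n)))
    where
    tag : ∀ k {δν} → δν ∈ splitPairsAt k → sum (proj₂ δν) ≡ k
    tag k δν∈ = let _ , ν∈ = ∈-cartesianProduct⁻ (filter core? (partitions (n ∸ 2 * k))) (filter R? (partitions k)) δν∈ in
                proj₂ (proj₂ (∈-partitions⁻ (proj₁ (∈-filter⁻ R? {xs = partitions k} ν∈))))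

  numPartitions≡length-splitPairs : numPartitions n (R? ∘ pairedPart) ≡ length splitPairs
  numPartitions≡length-splitPairs = length-≡-inverse
    (Unique.filter⁺ (R? ∘ pairedPart) (partitions-unique n)) splitPairs-unique
    (λ p → corePart p , pairedPart p) (λ (δ , ν) → join δ ν) split∈ join∈
    (join-split ∘ ⊢n) join-split-join
    where
    ⊢n : ∀ {p} → p ∈ filter (R? ∘ pairedPart) (partitions n) → IsPartition n p
    ⊢n = ∈-partitions⁻ ∘ proj₁ ∘ ∈-filter⁻ (R? ∘ pairedPart) {xs = partitions n}

    split∈ : ∀ {p} → p ∈ filter (R? ∘ pairedPart) (partitions n) → (corePart p , pairedPart p) ∈ splitPairs
    split∈ {p} p∈ with split-valid (⊢n p∈)
    ... | core-δ , δ⊢ , ν⊢ , refl = ∈-splitPairs⁺ core-δ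
      (subst (λ s → IsPartition s (corePart p)) (sym (m+n∸n≡m (sum (corePart p)) (2 * sum (pairedPart p)))) δ⊢)
      ν⊢ (proj₂ (∈-filter⁻ (R? ∘ pairedPart) {xs = partitions n} p∈)) (m≤n+m _ (sum (corePart p)))

    join-split-join : ∀ {δν} → δν ∈ splitPairs →
                      (corePart (join (proj₁ δν) (proj₂ δν)) , pairedPart (join (proj₁ δν) (proj₂ δν))) ≡ δν
    join-split-join δν∈ with ∈-splitPairs⁻ δν∈
    ... | core-δ , δ⊢ , ν⊢ , _ = let eδ , eν = split-join core-δ δ⊢ ν⊢ in cong₂ _,_ eδ eν

    join∈ : ∀ {δν} → δν ∈ splitPairs → join (proj₁ δν) (proj₂ δν) ∈ filter (R? ∘ pairedPart) (partitions n)
    join∈ {δ , ν} δν∈ with ∈-splitPairs⁻ δν∈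
    ... | core-δ , δ⊢ , ν⊢ , rν , 2k≤n = ∈-filter⁺ (R? ∘ pairedPart)
      (∈-partitions⁺ (subst (λ s → IsPartition s (join δ ν)) (m∸n+n≡m 2k≤n) (join-valid core-δ δ⊢ ν⊢)))
      (subst R (sym (proj₂ (split-join core-δ δ⊢ ν⊢))) rν)

  decomposition : numPartitions n (R? ∘ pairedPart) ≡
                  sum (map (λ k → numPartitions (n ∸ 2 * k) core? * numPartitions k R?) (halves n))
  decomposition = begin
    numPartitions n (R? ∘ pairedPart)            ≡⟨ numPartitions≡length-splitPairs ⟩
    length splitPairs                            ≡⟨ length-concatMap splitPairsAt (halves n) ⟩
    sum (map (length ∘ splitPairsAt) (halves n)) ≡⟨ cong sum (map-cong length-splitPairsAt (halves n)) ⟩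
    sum (map (λ k → numPartitions (n ∸ 2 * k) core? * numPartitions k R?) (halves n)) ∎
    where
    open ≡-Reasoning
    length-splitPairsAt : ∀ k → length (splitPairsAt k) ≡ numPartitions (n ∸ 2 * k) core? * numPartitions k R?
    length-splitPairsAt k = length-cartesianProduct (filter core? (partitions (n ∸ 2 * k))) (filter R? (partitions k))

numPartitions-core-unique : (S T : Splitting) → ∀ n →
                            numPartitions n (Splitting.core? S) ≡ numPartitions n (Splitting.core? T)
numPartitions-core-unique S T = <-rec _ step
  where
  always? : Decidable {A = List ℕ} (λ _ → ⊤)
  always? _ = yes tt

  C : Splitting → ℕ → ℕ
  C U m = numPartitions m (Splitting.core? U)

  positiveHalves : ℕ → List ℕ
  positiveHalves n = filter (λ k → 2 * k ≤? n) (applyUpTo suc n)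

  rest : Splitting → ℕ → ℕ
  rest U n = sum (map (λ k → C U (n ∸ 2 * k) * numPartitions k always?) (positiveHalves n))

  -- halves n is 0 ∷ positiveHalves n and numPartitions 0 always? is 1, so the k = 0 term of the
  -- decomposition is C U n * 1, and rest U n involves C U only at arguments smaller than n.
  total≡ : ∀ U n → numPartitions n always? ≡ C U n * 1 + rest U n
  total≡ U n = Decomposition.decomposition U always? n

  step : ∀ n → (∀ {m} → m < n → C S m ≡ C T m) → C S n ≡ C T n
  step n ih = *-cancelʳ-≡ (C S n) (C T n) 1 (+-cancelʳ-≡ _ _ _ (begin
    C S n * 1 + rest S n    ≡⟨ total≡ S n ⟨
    numPartitions n always? ≡⟨ total≡ T n ⟩
    C T n * 1 + rest T n    ≡⟨ cong (C T n * 1 +_) rest≡ ⟨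
    C T n * 1 + rest S n    ∎))
    where
    open ≡-Reasoning
    smaller : ∀ {k} → k ∈ positiveHalves n →
              C S (n ∸ 2 * k) * numPartitions k always? ≡ C T (n ∸ 2 * k) * numPartitions k always?
    smaller {k} k∈ with ∈-filter⁻ (λ k → 2 * k ≤? n) {xs = applyUpTo suc n} k∈
    ... | k∈ₙ , 2k≤n with ∈-applyUpTo⁻ suc k∈ₙ
    ...   | i , _ , refl = cong (_* numPartitions k always?) (ih (∸-monoʳ-< {o = 0} (s≤s z≤n) 2k≤n))
    rest≡ : rest S n ≡ rest T n
    rest≡ = cong sum (map-cong-local (All.tabulate smaller))

filter-∁-++-filter-↭ : ∀ {P : ℕ → Set} (P? : Decidable P) xs → filter (¬? ∘ P?) xs ++ filter P? xs ↭ xs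
filter-∁-++-filter-↭ P? []       = ↭-refl
filter-∁-++-filter-↭ P? (x ∷ xs) with P? x
... | yes _ = ↭-trans (shift x (filter (¬? ∘ P?) xs) (filter P? xs)) (↭-prep x (filter-∁-++-filter-↭ P? xs))
... | no _  = ↭-prep x (filter-∁-++-filter-↭ P? xs)

even? : Decidable (2 ∣_)
even? = 2 ∣?_

odd? : Decidable (¬_ ∘ (2 ∣_))
odd? = ¬? ∘ even?

double : ℕ → ℕ
double a = a * 2

half : ℕ → ℕ
half a = a / 2

half-double : ∀ a → half (double a) ≡ a
half-double a = m*n/n≡m a 2

double-half : ∀ {a} → 2 ∣ a → double (half a) ≡ a
double-half (divides q refl) = cong double (half-double q)

sum-map-double : ∀ xs → sum (map double xs) ≡ 2 * sum xs
sum-map-double []       = refl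
sum-map-double (x ∷ xs) = trans (cong₂ _+_ (*-comm x 2) (sum-map-double xs)) (sym (*-distribˡ-+ 2 x (sum xs)))

oddEvenSplitting : Splitting
oddEvenSplitting = record
  { Core        = All (¬_ ∘ (2 ∣_))
  ; core?       = All.all? odd?
  ; corePart    = filter odd?
  ; pairedPart  = map half ∘ filter even?
  ; join        = λ δ ν → sort (δ ++ map double ν)
  ; split-valid = split-valid
  ; join-valid  = join-valid
  ; join-split  = join-split
  ; split-join  = split-join
  }
  where
  evens-doubled-halves : ∀ xs → map double (map half (filter even? xs)) ≡ filter even? xs
  evens-doubled-halves xs = map-double-half (All.all-filter even? xs)
    where
    map-double-half : ∀ {ys} → All (2 ∣_) ys → map double (map half ys) ≡ ys
    map-double-half []           = refl
    map-double-half (2∣y ∷ 2∣ys) = cong₂ _∷_ (double-half 2∣y) (map-double-half 2∣ys)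

  half-positive : ∀ {a} → 2 ∣ a → 1 ≤ a → 1 ≤ half a
  half-positive (divides (suc q) refl) _ = subst (1 ≤_) (sym (half-double (suc q))) (s≤s z≤n)

  split-valid : ∀ {n p} → IsPartition n p → Split (All (¬_ ∘ (2 ∣_))) n (filter odd? p) (map half (filter even? p))
  split-valid {p = p} (p↘ , p⁺ , Σp≡n) =
    All.all-filter odd? p ,
    (Sorted.filter⁺ ≥-totalOrder odd? p↘ , All.filter⁺ odd? p⁺ , refl) ,
    (Sorted.map⁺ ≥-totalOrder ≥-totalOrder (/-monoˡ-≤ 2) (Sorted.filter⁺ ≥-totalOrder even? p↘) ,
     All.map⁺ (All.tabulate (λ x∈ → let x∈p , 2∣x = ∈-filter⁻ even? {xs = p} x∈ in
                                    half-positive 2∣x (All.lookup p⁺ x∈p))) ,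
     refl) ,
    (begin
      sum (filter odd? p) + 2 * sum (map half (filter even? p))
        ≡⟨ cong (sum (filter odd? p) +_) (sum-map-double (map half (filter even? p))) ⟨
      sum (filter odd? p) + sum (map double (map half (filter even? p)))
        ≡⟨ cong (λ ys → sum (filter odd? p) + sum ys) (evens-doubled-halves p) ⟩
      sum (filter odd? p) + sum (filter even? p)                          ≡⟨ sum-++ (filter odd? p) (filter even? p) ⟨
      sum (filter odd? p ++ filter even? p)                               ≡⟨ sum-↭ (filter-∁-++-filter-↭ even? p) ⟩
      sum p                                                               ≡⟨ Σp≡n ⟩
      _                                                                   ∎)
    where open ≡-Reasoning

  join-valid : ∀ {a b δ ν} → All (¬_ ∘ (2 ∣_)) δ → IsPartition a δ → IsPartition b ν →
               IsPartition (a + 2 * b) (sort (δ ++ map double ν))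
  join-valid {δ = δ} {ν} _ (_ , δ⁺ , refl) (_ , ν⁺ , refl) = sort-isPartition
    (All.++⁺ δ⁺ (All.map⁺ (All.map (λ {x} 1≤x → ≤-trans 1≤x (m≤m*n x 2)) ν⁺)))
    (trans (sum-++ δ (map double ν)) (cong (sum δ +_) (sum-map-double ν)))

  join-split : ∀ {n p} → IsPartition n p → sort (filter odd? p ++ map double (map half (filter even? p))) ≡ p
  join-split {p = p} (p↘ , _ , _) rewrite evens-doubled-halves p =
    nonIncreasing-↭⇒≡ (sort-↗ _) p↘ (↭-trans (sort-↭ _) (filter-∁-++-filter-↭ even? p))

  split-join : ∀ {a b δ ν} → All (¬_ ∘ (2 ∣_)) δ → IsPartition a δ → IsPartition b ν →
               filter odd? (sort (δ ++ map double ν)) ≡ δ × map half (filter even? (sort (δ ++ map double ν))) ≡ ν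
  split-join {δ = δ} {ν} odd-δ (δ↘ , _) (ν↘ , _) =
    nonIncreasing-↭⇒≡ (Sorted.filter⁺ ≥-totalOrder odd? (sort-↗ X)) δ↘
                      (↭-trans (filter-↭ odd? (sort-↭ X)) (↭-reflexive odds)) ,
    trans (cong (map half) (nonIncreasing-↭⇒≡ (Sorted.filter⁺ ≥-totalOrder even? (sort-↗ X)) 2ν↘
                             (↭-trans (filter-↭ even? (sort-↭ X)) (↭-reflexive evens))))
          (map-half-double ν)
    where
    X : List ℕ
    X = δ ++ map double ν
    even-2ν : All (2 ∣_) (map double ν)
    even-2ν = All.map⁺ (All.universal (λ x → divides x refl) ν)
    2ν↘ : NonIncreasing (map double ν)
    2ν↘ = Sorted.map⁺ ≥-totalOrder ≥-totalOrder (*-monoˡ-≤ 2) ν↘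
    odds : filter odd? X ≡ δ
    odds = trans (filter-++ odd? δ (map double ν))
                 (trans (cong₂ _++_ (filter-all odd? odd-δ)
                                    (filter-none odd? (All.map (λ 2∣x ¬2∣x → ¬2∣x 2∣x) even-2ν)))
                        (++-identityʳ δ))
    evens : filter even? X ≡ map double ν
    evens = trans (filter-++ even? δ (map double ν)) (cong₂ _++_ (filter-none even? odd-δ) (filter-all even? even-2ν))
    map-half-double : ∀ ys → map half (map double ys) ≡ ys
    map-half-double []       = refl
    map-half-double (y ∷ ys) = cong₂ _∷_ (half-double y) (map-half-double ys)

StrictlyDecreasing : List ℕ → Set
StrictlyDecreasing = AllPairs (λ a b → b < a)

StrictlyDecreasing⇒NonIncreasing : ∀ {xs} → StrictlyDecreasing xs → NonIncreasing xs
StrictlyDecreasing⇒NonIncreasing = Sorted.AllPairs⇒Sorted ≥-totalOrder ∘ AllPairs.map <⇒≤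

StrictlyDecreasing⇒mult≤1 : ∀ {xs} → StrictlyDecreasing xs → ∀ c → mult c xs ≤ 1
StrictlyDecreasing⇒mult≤1 []                 c = z≤n
StrictlyDecreasing⇒mult≤1 {x ∷ xs} (xs<x ∷ xs↘) c with c ≟ x
... | yes refl = ≤-reflexive (trans (count-accept (c ≟_) xs refl)
                                    (cong suc (count-none (c ≟_) (All.map (λ y<c c≡y → <-irrefl (sym c≡y) y<c) xs<x))))
... | no c≢x   = ≤-trans (≤-reflexive (count-reject (c ≟_) xs c≢x)) (StrictlyDecreasing⇒mult≤1 xs↘ c)

m+[m+2*n]≡2*[m+n] : ∀ m n → m + (m + 2 * n) ≡ 2 * (m + n)
m+[m+2*n]≡2*[m+n] = solve-∀

twice : List ℕ → List ℕ
twice []      = []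
twice (a ∷ ν) = a ∷ a ∷ twice ν

module _ {P : ℕ → Set} (P? : Decidable P) where

  count-twice : ∀ xs → count P? (twice xs) ≡ 2 * count P? xs
  count-twice []       = refl
  count-twice (x ∷ xs) = begin
    count P? (x ∷ x ∷ twice xs)          ≡⟨ count-++ P? [ x ] (x ∷ twice xs) ⟩
    c + count P? (x ∷ twice xs)          ≡⟨ cong (c +_) (count-++ P? [ x ] (twice xs)) ⟩
    c + (c + count P? (twice xs))        ≡⟨ cong (λ t → c + (c + t)) (count-twice xs) ⟩
    c + (c + 2 * count P? xs)            ≡⟨ m+[m+2*n]≡2*[m+n] c (count P? xs) ⟩
    2 * (c + count P? xs)                ≡⟨ cong (2 *_) (count-++ P? [ x ] xs) ⟨
    2 * count P? (x ∷ xs)                ∎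
    where
    open ≡-Reasoning
    c = count P? [ x ]

sum-twice : ∀ xs → sum (twice xs) ≡ 2 * sum xs
sum-twice []       = refl
sum-twice (x ∷ xs) = trans (cong (λ s → x + (x + s)) (sum-twice xs)) (m+[m+2*n]≡2*[m+n] x (sum xs))

All-twice⁺ : ∀ {Q : ℕ → Set} {xs} → All Q xs → All Q (twice xs)
All-twice⁺ []         = []
All-twice⁺ (q ∷ qs)   = q ∷ q ∷ All-twice⁺ qs

All-twice⁻ : ∀ {Q : ℕ → Set} xs → All Q (twice xs) → All Q xs
All-twice⁻ []       _              = []
All-twice⁻ (x ∷ xs) (q ∷ _ ∷ qs)  = q ∷ All-twice⁻ xs qs

-- In a non-increasing list equal parts are adjacent, so pairing off adjacent equal parts leaves each
-- value at most once in the first component.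
unpairStep : ∀ {a b : ℕ} → Dec (a ≡ b) → List ℕ × List ℕ → List ℕ × List ℕ → List ℕ × List ℕ
unpairStep {a} (yes _) (δ , ν) _       = δ , a ∷ ν
unpairStep {a} (no _)  _       (δ , ν) = a ∷ δ , ν

unpair : List ℕ → List ℕ × List ℕ
unpair []          = [] , []
unpair (a ∷ [])    = a ∷ [] , []
unpair (a ∷ b ∷ p) = unpairStep (a ≟ b) (unpair p) (unpair (b ∷ p))

recombine : List ℕ × List ℕ → List ℕ
recombine (δ , ν) = δ ++ twice ν

unpair-↭ : ∀ p → recombine (unpair p) ↭ p
unpair-↭ []          = ↭-refl
unpair-↭ (a ∷ [])    = ↭-refl
unpair-↭ (a ∷ b ∷ p) = step (a ≟ b) (unpair p) (unpair (b ∷ p)) (unpair-↭ p) (unpair-↭ (b ∷ p))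
  where
  step : (a≟b : Dec (a ≡ b)) (x y : List ℕ × List ℕ) → recombine x ↭ p → recombine y ↭ b ∷ p →
         recombine (unpairStep a≟b x y) ↭ a ∷ b ∷ p
  step (yes refl) (δ , ν) _ x↭ _ = begin
    δ ++ a ∷ a ∷ twice ν ↭⟨ shift a δ (a ∷ twice ν) ⟩
    a ∷ δ ++ a ∷ twice ν ↭⟨ ↭-prep a (shift a δ (twice ν)) ⟩
    a ∷ a ∷ δ ++ twice ν ↭⟨ ↭-prep a (↭-prep a x↭) ⟩
    a ∷ a ∷ p            ∎
    where open PermutationReasoning
  step (no _) _ (δ , ν) _ y↭ = ↭-prep a y↭

unpair-All : ∀ {Q : ℕ → Set} {p} → All Q p → All Q (proj₁ (unpair p)) × All Q (proj₂ (unpair p))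
unpair-All {p = p} qs with All-resp-↭ (↭-sym (unpair-↭ p)) qs
... | q-recombined =
  All.++⁻ˡ (proj₁ (unpair p)) q-recombined , All-twice⁻ (proj₂ (unpair p)) (All.++⁻ʳ (proj₁ (unpair p)) q-recombined)

mult-unpair : ∀ c p → mult c p ≡ mult c (proj₁ (unpair p)) + 2 * mult c (proj₂ (unpair p))
mult-unpair c p = trans (count-↭ (c ≟_) (↭-sym (unpair-↭ p)))
  (trans (count-++ (c ≟_) (proj₁ (unpair p)) _)
         (cong (mult c (proj₁ (unpair p)) +_) (count-twice (c ≟_) (proj₂ (unpair p)))))

SortedPair : List ℕ × List ℕ → Set
SortedPair (δ , ν) = StrictlyDecreasing δ × AllPairs (λ a b → b ≤ a) ν

unpair-sorted : ∀ {p} → AllPairs (λ a b → b ≤ a) p → SortedPair (unpair p)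
unpair-sorted {[]}          _ = [] , []
unpair-sorted {a ∷ []}      _ = [] ∷ [] , []
unpair-sorted {a ∷ b ∷ p} (a≥ ∷ b∷p↘@(b≥ ∷ p↘)) =
  step (a ≟ b) (unpair p) (unpair (b ∷ p)) (unpair-sorted p↘) (unpair-sorted b∷p↘)
    (proj₂ (unpair-All (All.tail a≥)))
    (λ a≢b → let b<a = ≤∧≢⇒< (All.head a≥) (a≢b ∘ sym) in
             proj₁ (unpair-All (b<a ∷ All.map (λ x≤b → ≤-<-trans x≤b b<a) b≥)))
  where
  step : (a≟b : Dec (a ≡ b)) (x y : List ℕ × List ℕ) → SortedPair x → SortedPair y →
         All (_≤ a) (proj₂ x) → (a ≢ b → All (_< a) (proj₁ y)) → SortedPair (unpairStep a≟b x y)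
  step (yes _) (δ , ν) _ (δ↘ , ν↘) _ ν≤a _ = δ↘ , ν≤a ∷ ν↘
  step (no a≢b) _ (δ , ν) _ (δ↘ , ν↘) _ δ<a = δ<a a≢b ∷ δ↘ , ν↘

m+2*n-injective : ∀ {m n m′ n′} → m ≤ 1 → m′ ≤ 1 → m + 2 * n ≡ m′ + 2 * n′ → m ≡ m′ × n ≡ n′
m+2*n-injective {0} {n} {0} {n′} _ _ eq = refl , *-cancelˡ-≡ n n′ 2 eq
m+2*n-injective {0} {n} {1} {n′} _ _ eq = contradiction eq (even≢odd n n′)
m+2*n-injective {1} {n} {0} {n′} _ _ eq = contradiction (sym eq) (even≢odd n′ n)
m+2*n-injective {1} {n} {1} {n′} _ _ eq = refl , *-cancelˡ-≡ n n′ 2 (suc-injective eq)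
m+2*n-injective {suc (suc _)} (s≤s ()) _
m+2*n-injective {_} {_} {suc (suc _)} _ (s≤s ())

distinctSplitting : Splitting
distinctSplitting = record
  { Core        = StrictlyDecreasing
  ; core?       = AllPairs.allPairs? (λ a b → b <? a)
  ; corePart    = proj₁ ∘ unpair
  ; pairedPart  = proj₂ ∘ unpair
  ; join        = λ δ ν → sort (δ ++ twice ν)
  ; split-valid = split-valid
  ; join-valid  = join-valid
  ; join-split  = λ {_} {p} (p↘ , _) → nonIncreasing-↭⇒≡ (sort-↗ _) p↘ (↭-trans (sort-↭ _) (unpair-↭ p))
  ; split-join  = split-join
  }
  where
  split-valid : ∀ {n p} → IsPartition n p → Split StrictlyDecreasing n (proj₁ (unpair p)) (proj₂ (unpair p))
  split-valid {p = p} (p↘ , p⁺ , Σp≡n) with unpair-sorted (NonIncreasing⇒AllPairs p↘) | unpair-All p⁺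
  ... | δ↘ , ν↘ | δ⁺ , ν⁺ =
    δ↘ ,
    (StrictlyDecreasing⇒NonIncreasing δ↘ , δ⁺ , refl) ,
    (Sorted.AllPairs⇒Sorted ≥-totalOrder ν↘ , ν⁺ , refl) ,
    (begin
      sum (proj₁ (unpair p)) + 2 * sum (proj₂ (unpair p))
                                                               ≡⟨ cong (sum (proj₁ (unpair p)) +_) (sum-twice (proj₂ (unpair p))) ⟨
      sum (proj₁ (unpair p)) + sum (twice (proj₂ (unpair p))) ≡⟨ sum-++ (proj₁ (unpair p)) _ ⟨
      sum (recombine (unpair p))                               ≡⟨ sum-↭ (unpair-↭ p) ⟩
      sum p                                                    ≡⟨ Σp≡n ⟩
      _                                                        ∎)
    where open ≡-Reasoning

  join-valid : ∀ {a b δ ν} → StrictlyDecreasing δ → IsPartition a δ → IsPartition b ν →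
               IsPartition (a + 2 * b) (sort (δ ++ twice ν))
  join-valid {δ = δ} {ν} _ (_ , δ⁺ , refl) (_ , ν⁺ , refl) =
    sort-isPartition (All.++⁺ δ⁺ (All-twice⁺ ν⁺)) (trans (sum-++ δ (twice ν)) (cong (sum δ +_) (sum-twice ν)))

  split-join : ∀ {a b δ ν} → StrictlyDecreasing δ → IsPartition a δ → IsPartition b ν →
               proj₁ (unpair (sort (δ ++ twice ν))) ≡ δ × proj₂ (unpair (sort (δ ++ twice ν))) ≡ ν
  split-join {δ = δ} {ν} δ↘ _ (ν↘ , _) with unpair-sorted (NonIncreasing⇒AllPairs (sort-↗ (δ ++ twice ν)))
  ... | δ′↘ , ν′↘ =
    mult-nonIncreasing⇒≡ (StrictlyDecreasing⇒NonIncreasing δ′↘) (StrictlyDecreasing⇒NonIncreasing δ↘) (proj₁ ∘ mult≡) ,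
    mult-nonIncreasing⇒≡ (Sorted.AllPairs⇒Sorted ≥-totalOrder ν′↘) ν↘ (proj₂ ∘ mult≡)
    where
    X : List ℕ
    X = sort (δ ++ twice ν)
    mult≡ : ∀ c → mult c (proj₁ (unpair X)) ≡ mult c δ × mult c (proj₂ (unpair X)) ≡ mult c ν
    mult≡ c = m+2*n-injective (StrictlyDecreasing⇒mult≤1 δ′↘ c) (StrictlyDecreasing⇒mult≤1 δ↘ c) (begin
      mult c (proj₁ (unpair X)) + 2 * mult c (proj₂ (unpair X)) ≡⟨ mult-unpair c X ⟨
      mult c X                                                   ≡⟨ count-↭ (c ≟_) (sort-↭ (δ ++ twice ν)) ⟩
      mult c (δ ++ twice ν)                                      ≡⟨ count-++ (c ≟_) δ (twice ν) ⟩
      mult c δ + mult c (twice ν)                                ≡⟨ cong (mult c δ +_) (count-twice (c ≟_) ν) ⟩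
      mult c δ + 2 * mult c ν                                    ∎)
      where open ≡-Reasoning

largestRepeatingPart-unpair : ∀ {p} → NonIncreasing p → largestRepeatingPart p ≡ largestPart (proj₂ (unpair p))
largestRepeatingPart-unpair {p} p↘ = IsLargestRepeatingPart-unique (largestRepeatingPart-spec p) (repeated , rare-above)
  where
  δ ν : List ℕ
  δ = proj₁ (unpair p)
  ν = proj₂ (unpair p)
  δ↘ : StrictlyDecreasing δ
  δ↘ = proj₁ (unpair-sorted (NonIncreasing⇒AllPairs p↘))

  repeated : largestPart ν ≡ 0 ⊎ 2 ≤ mult (largestPart ν) p
  repeated with largestPart-∈ ν
  ... | inj₁ ≡0  = inj₁ ≡0
  ... | inj₂ ∈ν  = inj₂ (subst (2 ≤_) (sym (mult-unpair (largestPart ν) p))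
                          (≤-trans (*-monoʳ-≤ 2 (∈⇒mult-pos ∈ν)) (m≤n+m _ (mult (largestPart ν) δ))))

  rare-above : ∀ a → largestPart ν < a → mult a p < 2
  rare-above a ν<a =
    subst (_< 2) (sym (trans (mult-unpair a p) (trans (cong (λ m → mult a δ + 2 * m) mult≡0) (+-identityʳ _))))
          (s≤s (StrictlyDecreasing⇒mult≤1 δ↘ a))
    where
    mult≡0 : mult a ν ≡ 0
    mult≡0 = count-none (a ≟_)
               (All.map (λ x≤ a≡x → <⇒≱ ν<a (subst (_≤ largestPart ν) (sym a≡x) x≤)) (largestPart-ub ν))

numPartitions-numEvenParts≡largestRepeatingPart : ∀ j n →
  numPartitions n (λ p → numEvenParts p ≟ j) ≡ numPartitions n (λ p → largestRepeatingPart p ≟ j)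
numPartitions-numEvenParts≡largestRepeatingPart j n = begin
  numPartitions n (λ p → numEvenParts p ≟ j)
    ≡⟨ numPartitions-cong n _ _ (λ {p} _ → ≡-cong⇔ (sym (length-map half (filter even? p)))) ⟩
  numPartitions n (length≟j ∘ Splitting.pairedPart oddEvenSplitting)
    ≡⟨ Decomposition.decomposition oddEvenSplitting length≟j n ⟩
  sum (map (λ k → numOdd (n ∸ 2 * k) * numPartitions k length≟j) (halves n))
    ≡⟨ cong sum (map-cong (λ k → cong₂ _*_ (numPartitions-core-unique oddEvenSplitting distinctSplitting (n ∸ 2 * k))
                                            (numPartitions-length≡largestPart k j)) (halves n)) ⟩
  sum (map (λ k → numDistinct (n ∸ 2 * k) * numPartitions k largestPart≟j) (halves n))
    ≡⟨ Decomposition.decomposition distinctSplitting largestPart≟j n ⟨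
  numPartitions n (largestPart≟j ∘ Splitting.pairedPart distinctSplitting)
    ≡⟨ numPartitions-cong n _ _ (λ (p↘ , _) → ≡-cong⇔ (sym (largestRepeatingPart-unpair p↘))) ⟩
  numPartitions n (λ p → largestRepeatingPart p ≟ j) ∎
  where
  open ≡-Reasoning
  length≟j : Decidable (λ ν → length ν ≡ j)
  length≟j ν = length ν ≟ j
  largestPart≟j : Decidable (λ ν → largestPart ν ≡ j)
  largestPart≟j ν = largestPart ν ≟ j
  numOdd numDistinct : ℕ → ℕ
  numOdd m = numPartitions m (Splitting.core? oddEvenSplitting)
  numDistinct m = numPartitions m (Splitting.core? distinctSplitting)
  ≡-cong⇔ : ∀ {x y} → x ≡ y → (x ≡ j) ⇔ (y ≡ j)
  ≡-cong⇔ x≡y = mk⇔ (trans (sym x≡y)) (trans x≡y)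

numPartitions-largestRepeatingPart≡numPartsAboveMex : ∀ j n →
  numPartitions n (λ p → largestRepeatingPart p ≟ j) ≡ numPartitions n (λ p → numPartsAboveMex p ≟ j)
numPartitions-largestRepeatingPart≡numPartsAboveMex j n = numPartitions-conjugate n _ _
  (λ {p} (p↘ , p⁺ , _) → trans (trans (numPartsAboveMex≡largestRepeatingPart-conjugate (conjugate p))
                                      (cong largestRepeatingPart (conjugate-involutive p↘ p⁺))))
  (λ {p} _ → trans (sym (numPartsAboveMex≡largestRepeatingPart-conjugate p)))

proposition2p2 : (j n : ℕ) →
    (numPartitions n (λ p → numEvenParts p ≟ j)
      ≡ numPartitions n (λ p → largestRepeatingPart p ≟ j))
    × (numPartitions n (λ p → largestRepeatingPart p ≟ j)
      ≡ numPartitions n (λ p → numPartsAboveMex p ≟ j))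
proposition2p2 j n =
  numPartitions-numEvenParts≡largestRepeatingPart j n , numPartitions-largestRepeatingPart≡numPartsAboveMex j n
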